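{- For each positive integer $t$ there is an integer $n_2(t)$ such that every separated rotation system of size at least $n_2(t)$ has a rotation subsystem of size $t$ that is forward monotone, and a rotation subsystem of size $t$ that is backward monotone.
   Context: An (abstract) rotation system $\Pi$ on a finite set of integers $\{i_1,\ldots,i_n\}$ with $i_1<\cdots<i_n$ (its ground set; $n$ is its size) is an $n$-tuple $(\Pi(i_1),\ldots,\Pi(i_n))$, where each $\Pi(i_j)$ is a cyclic permutation (cyclic ordering) of $\{i_1,\ldots,i_n\}\setminus\{i_j\}$. For a subset $S$ of the ground set, the rotation subsystem induced by $S$ has ground set $S$ (ordered as integers) and assigns to each $x\in S$ the cyclic order on $S\setminus\{x\}$ obtained from $\Pi(x)$ by deleting the elements not in $S$. $\Pi(i_j)$ is separated if the cyclic permutation $\Pi(i_j)$ can be written as $(\sigma\tau)$, where $\sigma$ is a linear ordering of $\{i_1,\ldots,i_{j-1}\}$ and $\tau$ is a linear ordering of $\{i_{j+1},\ldots,i_n\}$; $\Pi$ is separated if every $\Pi(i_j)$ is separated. A separated $\Pi(i_j)=(\sigma\tau)$ is backward monotone if $\sigma=i_1\cdots i_{j-1}$ or $\sigma=i_{j-1}\cdots i_1$, and forward monotone if $\tau=i_{j+1}\cdots i_n$ or $\tau=i_n\cdots i_{j+1}$. A (separated) rotation system is forward (resp. backward) monotone if $\Pi(i_j)$ is forward (resp. backward) monotone for every $j$. -}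

module Defs where

open import Data.Nat using (ℕ; zero; suc)
open import Data.Integer as ℤ using (ℤ; _<_; _>_; _<?_; _≟_)
open import Data.List using (List; []; _∷_; _++_; filter; drop; take; reverse; length)
open import Data.List.Membership.Propositional using (_∈_)
open import Data.List.Membership.DecPropositional _≟_ using (_∈?_)
open import Data.List.Relation.Binary.Permutation.Propositional using (_↭_)
open import Data.List.Relation.Unary.Linked using (Linked)
open import Data.Product using (Σ; ∃; ∃-syntax; _×_; _,_)
open import Data.Sum using (_⊎_)
open import Relation.Nullary using (¬?)
open import Relation.Binary.PropositionalEquality using (_≡_)

-- A ground set: a finite set of integers listed as i₁ < ⋯ < iₙ.
StrictlyIncreasing : List ℤ → Set
StrictlyIncreasing = Linked _<_

others : ℤ → List ℤ → List ℤ
others x G = filter (λ y → ¬? (y ≟ x)) G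

below : ℤ → List ℤ → List ℤ
below x G = filter (λ y → y <? x) G

above : ℤ → List ℤ → List ℤ
above x G = filter (λ y → x <? y) G

-- A cyclic permutation is represented by a linear list (one of its
-- linearisations); two lists represent the same cyclic order iff one is a
-- rotation of the other.
_≈cyc_ : List ℤ → List ℤ → Set
L ≈cyc M = ∃[ k ] M ≡ drop k L ++ take k L

-- An (abstract) rotation system on ground set G: for every x ∈ G, rot x is a
-- linearisation of a cyclic ordering of G ∖ {x}.
IsRotationSystem : List ℤ → (ℤ → List ℤ) → Set
IsRotationSystem G rot =
  StrictlyIncreasing G × (∀ x → x ∈ G → rot x ↭ others x G)

-- Rotation subsystem induced by S: delete the elements not in S from each
-- cyclic order (filtering a linearisation of a cyclic order is well defined
-- on cyclic orders).  Its ground set is S.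
induced : List ℤ → (ℤ → List ℤ) → (ℤ → List ℤ)
induced S rot x = filter (λ y → y ∈? S) (rot x)

SeparatedAs : List ℤ → (ℤ → List ℤ) → ℤ → List ℤ → List ℤ → Set
SeparatedAs G rot x σ τ =
  (rot x ≈cyc (σ ++ τ)) × (σ ↭ below x G) × (τ ↭ above x G)

SeparatedAt : List ℤ → (ℤ → List ℤ) → ℤ → Set
SeparatedAt G rot x = ∃[ σ ] ∃[ τ ] SeparatedAs G rot x σ τ

Separated : List ℤ → (ℤ → List ℤ) → Set
Separated G rot = ∀ x → x ∈ G → SeparatedAt G rot x

BackwardMonotoneAt : List ℤ → (ℤ → List ℤ) → ℤ → Set
BackwardMonotoneAt G rot x = ∃[ σ ] ∃[ τ ]
  (SeparatedAs G rot x σ τ × (σ ≡ below x G ⊎ σ ≡ reverse (below x G)))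

ForwardMonotoneAt : List ℤ → (ℤ → List ℤ) → ℤ → Set
ForwardMonotoneAt G rot x = ∃[ σ ] ∃[ τ ]
  (SeparatedAs G rot x σ τ × (τ ≡ above x G ⊎ τ ≡ reverse (above x G)))

BackwardMonotone : List ℤ → (ℤ → List ℤ) → Set
BackwardMonotone G rot = Separated G rot × (∀ x → x ∈ G → BackwardMonotoneAt G rot x)

ForwardMonotone : List ℤ → (ℤ → List ℤ) → Set
ForwardMonotone G rot = Separated G rot × (∀ x → x ∈ G → ForwardMonotoneAt G rot x)

module Submission where

-- Fix a separation Π(x) = (σ x)(τ x) for every x ∈ G.  For the forward case
-- colour a pair a < b of elements above x by whether a precedes b in τ x.
-- A greedy use of Ramsey's theorem for two colours yields a subsequence
-- x₁ < ⋯ < xₜ of G that is end-homogeneous: for every i, all pairs after xᵢ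
-- receive the same colour under the colouring of xᵢ.  Restricted to this
-- subsequence S, τ xᵢ is then a duplicate-free list whose order on the
-- elements of S above xᵢ is either increasing or decreasing, which is
-- exactly forward monotonicity at xᵢ.  The backward case is the same
-- selection run on G read backwards, colouring by σ.

open import Defs
open import Data.Nat using (ℕ; zero; suc; _≤_; _+_; s≤s)
open import Data.Nat.Properties using (+-suc; ≤-trans; ≤-reflexive; _≤?_; ≰⇒>; <⇒≱; +-mono-<)
open import Data.Integer as ℤ using (ℤ; _<_; _>_; _<?_)
open import Data.Integer.Properties using (<-asym; <-irrefl; <-trans)
open import Data.List using (List; []; _∷_; _++_; [_]; filter; drop; take; reverse; length)
open import Data.List.Properties
  using ( filter-++; filter-all; filter-reject; take++drop≡id
        ; unfold-reverse; reverse-++; reverse-involutive; length-reverse)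
open import Data.List.Membership.Propositional using (_∈_)
open import Data.List.Membership.Propositional.Properties using (∈-filter⁻; ∈-filter⁺)
open import Data.List.Membership.DecPropositional ℤ._≟_ using (_∈?_)
open import Data.List.Relation.Unary.Any using (here; there)
import Data.List.Relation.Unary.Any.Properties as Any
open import Data.List.Relation.Unary.All as All using (All; []; _∷_)
open import Data.List.Relation.Unary.All.Properties using (all-filter)
open import Data.List.Relation.Unary.AllPairs as AllPairs using (AllPairs; []; _∷_)
import Data.List.Relation.Unary.AllPairs.Properties as AllPairs
open import Data.List.Relation.Unary.Unique.Propositional using (Unique)
open import Data.List.Relation.Unary.Unique.Propositional.Properties using (Unique[x∷xs]⇒x∉xs)
import Data.List.Relation.Unary.Unique.Propositional.Properties as Unique
open import Data.List.Relation.Unary.Linked.Properties using (Linked⇒AllPairs)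
open import Data.List.Relation.Binary.Sublist.Propositional
  using (_⊆_; []; _∷_; _∷ʳ_; ⊆-trans; minimum; from∈; to∈; lookup)
open import Data.List.Relation.Binary.Sublist.Propositional.Properties using (filter-⊆; All-resp-⊆)
import Data.List.Relation.Binary.Sublist.Propositional.Properties as Sublist
open import Data.List.Relation.Binary.Sublist.DecPropositional ℤ._≟_ using (_⊆?_)
open import Data.List.Relation.Binary.Permutation.Propositional using (_↭_; ↭-sym; ↭-trans; ↭⇒↭ₛ)
open import Data.List.Relation.Binary.Permutation.Propositional.Properties
  using (∈-resp-↭; filter-↭; ↭-reverse)
open import Data.Product using (∃-syntax; _×_; _,_; proj₁; proj₂)
open import Data.Sum using (_⊎_; inj₁; inj₂)
import Data.Sum as Sum
open import Data.Empty using (⊥-elim)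
open import Function using (_∘_; flip)
open import Relation.Nullary using (¬_; yes; no)
open import Relation.Unary using (Decidable)
open import Relation.Unary.Properties using (∁?)
open import Relation.Binary.Definitions using (Asymmetric) renaming (Decidable to Decidable₂)
open import Relation.Binary.PropositionalEquality
  using (_≡_; refl; sym; trans; cong; cong₂; subst; setoid; module ≡-Reasoning)
import Data.List.Relation.Binary.Permutation.Setoid.Properties as Permutation

private
  variable
    A : Set
    R : A → A → Set
    P : ℤ → Set
    a b x : A
    xs ys ρ F T L S : List A

AllPairs-⊆ : xs ⊆ ys → AllPairs R ys → AllPairs R xs
AllPairs-⊆ []        []        = []
AllPairs-⊆ (y ∷ʳ s)  (_ ∷ r)   = AllPairs-⊆ s r
AllPairs-⊆ (refl ∷ s) (Rx ∷ r) = All-resp-⊆ s Rx ∷ AllPairs-⊆ s r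

reverse-sorted : AllPairs (flip R) xs → AllPairs R (reverse xs)
reverse-sorted {xs = []}     []        = []
reverse-sorted {R = R} {xs = x ∷ xs} (Rx ∷ r) = subst (AllPairs R) (sym (unfold-reverse x xs))
  (AllPairs.++⁺ (reverse-sorted r) ([] ∷ [])
                (All.tabulate (λ y∈ → All.lookup Rx (Any.reverse⁻ y∈) ∷ [])))

-- In a list x ∷ xs sorted by an asymmetric R, x does not occur in xs; so a
-- membership implication into x ∷ ys restricts to one into ys.
drop-head : Asymmetric R → All (R x) xs → (∀ {a} → a ∈ xs → a ∈ x ∷ ys) → ∀ {a} → a ∈ xs → a ∈ ys
drop-head asym Rx f a∈xs with f a∈xs
... | here refl  = ⊥-elim (asym (All.lookup Rx a∈xs) (All.lookup Rx a∈xs))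
... | there a∈ys = a∈ys

sorted-unique : Asymmetric R → AllPairs R xs → AllPairs R ys →
                (∀ {a} → a ∈ xs → a ∈ ys) → (∀ {a} → a ∈ ys → a ∈ xs) → xs ≡ ys
sorted-unique asym [] [] _ _ = refl
sorted-unique asym [] (_ ∷ _) _ from with from (here refl)
... | ()
sorted-unique asym (_ ∷ _) [] to _ with to (here refl)
... | ()
sorted-unique {xs = x ∷ _} asym (Rx ∷ sx) (Ry ∷ sy) to from with to (here refl) | from (here refl)
... | here refl  | _          =
  cong (x ∷_) (sorted-unique asym sx sy (drop-head asym Rx (to ∘ there))
                                        (drop-head asym Ry (from ∘ there)))
... | there _    | here refl  =
  cong (x ∷_) (sorted-unique asym sx sy (drop-head asym Rx (to ∘ there))
                                        (drop-head asym Ry (from ∘ there)))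
... | there x∈ys | there y∈xs = ⊥-elim (asym (All.lookup Rx y∈xs) (All.lookup Ry x∈ys))

Precedes : List A → A → A → Set
Precedes ρ a b = a ∷ b ∷ [] ⊆ ρ

precedes-self : (xs : List A) → AllPairs (Precedes xs) xs
precedes-self []       = []
precedes-self (x ∷ xs) =
  All.tabulate (λ b∈xs → refl ∷ from∈ b∈xs) ∷ AllPairs.map (x ∷ʳ_) (precedes-self xs)

sublist-in-order : F ⊆ ρ → AllPairs (Precedes ρ) F
sublist-in-order {F = F} F⊆ρ = AllPairs.map (λ ab → ⊆-trans ab F⊆ρ) (precedes-self F)

precedes⇒related : AllPairs R L → Precedes L a b → R a b
precedes⇒related (Ra ∷ _) (refl ∷ b∈L) = All.lookup Ra (to∈ b∈L)
precedes⇒related (_ ∷ r)  (_ ∷ʳ ab)    = precedes⇒related r ab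

related⇒allPairs : (∀ {a b} → Precedes L a b → R a b) → AllPairs R L
related⇒allPairs {L = L} f = AllPairs.map f (precedes-self L)

second : b ∈ a ∷ b ∷ []
second = there (here refl)

precedes-asym : Unique ρ → Asymmetric (Precedes ρ)
precedes-asym (_ ∷ ρ!) (_ ∷ʳ ab)    (_ ∷ʳ ba)  = precedes-asym ρ! ab ba
precedes-asym ρ!       (refl ∷ b∈ρ) (refl ∷ _) = Unique[x∷xs]⇒x∉xs ρ! (to∈ b∈ρ)
precedes-asym ρ!       (refl ∷ _)   (_ ∷ʳ ba)  = Unique[x∷xs]⇒x∉xs ρ! (lookup ba second)
precedes-asym ρ!       (_ ∷ʳ ab)    (refl ∷ _) = Unique[x∷xs]⇒x∉xs ρ! (lookup ab second)

precedes-total : a ∈ ρ → b ∈ ρ → ¬ a ≡ b → Precedes ρ a b ⊎ Precedes ρ b a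
precedes-total (here refl) (here refl) a≢b = ⊥-elim (a≢b refl)
precedes-total (here refl) (there b∈ρ) _   = inj₁ (refl ∷ from∈ b∈ρ)
precedes-total (there a∈ρ) (here refl) _   = inj₂ (refl ∷ from∈ a∈ρ)
precedes-total (there a∈ρ) (there b∈ρ) a≢b = Sum.map (_ ∷ʳ_) (_ ∷ʳ_) (precedes-total a∈ρ b∈ρ a≢b)

Homogeneous : (A → A → Set) → List A → Set
Homogeneous R L = AllPairs R L ⊎ AllPairs (λ a b → ¬ R a b) L

homogeneous-⊆ : xs ⊆ ys → Homogeneous R ys → Homogeneous R xs
homogeneous-⊆ s = Sum.map (AllPairs-⊆ s) (AllPairs-⊆ s)

reverse-order : (∀ {a} → a ∈ T → a ∈ ρ) → Unique T →
                AllPairs (λ a b → ¬ Precedes ρ a b) T → AllPairs (flip (Precedes ρ)) T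
reverse-order {T = T} {ρ = ρ} T⊆ρ T! notInOrder = related⇒allPairs flipped
  where
  flipped : ∀ {a b} → Precedes T a b → Precedes ρ b a
  flipped ab with precedes-total (T⊆ρ (to∈ ab)) (T⊆ρ (lookup ab second))
                                 (precedes⇒related T! ab)
  ... | inj₁ ρab = ⊥-elim (precedes⇒related notInOrder ab ρab)
  ... | inj₂ ρba = ρba

homogeneous-restriction : Unique ρ → F ⊆ ρ → F ↭ T → Homogeneous (Precedes ρ) T →
                          F ≡ T ⊎ F ≡ reverse T
homogeneous-restriction ρ! F⊆ρ F↭T (inj₁ inOrder) =
  inj₁ (sorted-unique (precedes-asym ρ!) (sublist-in-order F⊆ρ) inOrder
                      (∈-resp-↭ F↭T) (∈-resp-↭ (↭-sym F↭T)))
homogeneous-restriction ρ! F⊆ρ F↭T (inj₂ notInOrder) =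
  inj₂ (sorted-unique (precedes-asym ρ!) (sublist-in-order F⊆ρ) (reverse-sorted reversed)
                      (Any.reverse⁺ ∘ ∈-resp-↭ F↭T) (∈-resp-↭ (↭-sym F↭T) ∘ Any.reverse⁻))
  where
  T! = Permutation.Unique-resp-↭ (setoid _) (↭⇒↭ₛ F↭T) (AllPairs-⊆ F⊆ρ ρ!)
  reversed = reverse-order (lookup F⊆ρ ∘ ∈-resp-↭ (↭-sym F↭T)) T! notInOrder

+-≤-split : ∀ {m n k l} → m + n ≤ k + l → m ≤ k ⊎ n ≤ l
+-≤-split {m} {n} {k} {l} m+n≤k+l with m ≤? k | n ≤? l
... | yes m≤k | _       = inj₁ m≤k
... | no _    | yes n≤l = inj₂ n≤l
... | no m≰k  | no n≰l  = ⊥-elim (<⇒≱ (+-mono-< (≰⇒> m≰k) (≰⇒> n≰l)) m+n≤k+l)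

length-filter-∁ : {P : A → Set} (P? : Decidable P) (xs : List A) →
                  length (filter P? xs) + length (filter (∁? P?) xs) ≡ length xs
length-filter-∁ P? []       = refl
length-filter-∁ P? (x ∷ xs) with P? x
... | yes _ = cong suc (length-filter-∁ P? xs)
... | no _  = trans (+-suc _ _) (cong suc (length-filter-∁ P? xs))

-- The classical upper bound for the Ramsey number R(p, q).
ramseyBound : ℕ → ℕ → ℕ
ramseyBound zero    _       = 0
ramseyBound (suc p) zero    = 0
ramseyBound (suc p) (suc q) = suc (ramseyBound p (suc q) + ramseyBound (suc p) q)

RamseyWitness : (A → A → Set) → ℕ → ℕ → List A → Set
RamseyWitness R p q L = ∃[ S ] (S ⊆ L ×
  ((length S ≡ p × AllPairs R S) ⊎ (length S ≡ q × AllPairs (λ a b → ¬ R a b) S)))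

module _ {R : A → A → Set} (R? : Decidable₂ R) where

  extend-related : ∀ {p q a L} → RamseyWitness R p (suc q) (filter (R? a) L) →
                   RamseyWitness R (suc p) (suc q) (a ∷ L)
  extend-related {a = a} {L} (S , S⊆ , inj₁ (|S| , related)) =
    a ∷ S , refl ∷ ⊆-trans S⊆ (filter-⊆ (R? a) L) ,
    inj₁ (cong suc |S| , All-resp-⊆ S⊆ (all-filter (R? a) L) ∷ related)
  extend-related {a = a} {L} (S , S⊆ , inj₂ w) =
    S , a ∷ʳ ⊆-trans S⊆ (filter-⊆ (R? a) L) , inj₂ w

  extend-unrelated : ∀ {p q a L} → RamseyWitness R (suc p) q (filter (∁? (R? a)) L) →
                     RamseyWitness R (suc p) (suc q) (a ∷ L)
  extend-unrelated {a = a} {L} (S , S⊆ , inj₂ (|S| , unrelated)) =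
    a ∷ S , refl ∷ ⊆-trans S⊆ (filter-⊆ (∁? (R? a)) L) ,
    inj₂ (cong suc |S| , All-resp-⊆ S⊆ (all-filter (∁? (R? a)) L) ∷ unrelated)
  extend-unrelated {a = a} {L} (S , S⊆ , inj₁ w) =
    S , a ∷ʳ ⊆-trans S⊆ (filter-⊆ (∁? (R? a)) L) , inj₁ w

  -- Ramsey: split off the first element a; one of its two neighbourhoods is
  -- large enough for the induction hypothesis.
  ramsey : ∀ p q L → ramseyBound p q ≤ length L → RamseyWitness R p q L
  ramsey zero    _       L _ = [] , minimum L , inj₁ (refl , [])
  ramsey (suc p) zero    L _ = [] , minimum L , inj₂ (refl , [])
  ramsey (suc p) (suc q) (a ∷ L) (s≤s bound)
    with +-≤-split (≤-trans bound (≤-reflexive (sym (length-filter-∁ (R? a) L))))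
  ... | inj₁ big = extend-related (ramsey p (suc q) (filter (R? a) L) big)
  ... | inj₂ big = extend-unrelated (ramsey (suc p) q (filter (∁? (R? a)) L) big)

diagonal-homogeneous : ∀ {p} →
  (length S ≡ p × AllPairs R S) ⊎ (length S ≡ p × AllPairs (λ a b → ¬ R a b) S) →
  length S ≡ p × Homogeneous R S
diagonal-homogeneous (inj₁ (|S| , related))   = |S| , inj₁ related
diagonal-homogeneous (inj₂ (|S| , unrelated)) = |S| , inj₂ unrelated

data EndHomogeneous (C : A → A → A → Set) : List A → Set where
  []  : EndHomogeneous C []
  _∷_ : ∀ {x L} → Homogeneous (C x) L → EndHomogeneous C L → EndHomogeneous C (x ∷ L)

endBound : ℕ → ℕ
endBound zero    = 0
endBound (suc t) = suc (ramseyBound (endBound t) (endBound t))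

-- Greedy selection: keep the first element x, pass to a C x-homogeneous
-- sublist of the rest (by Ramsey), and recurse inside it.
end-homogeneous : {C : A → A → A → Set} → (∀ x → Decidable₂ (C x)) →
                  ∀ t L → endBound t ≤ length L →
                  ∃[ S ] (S ⊆ L × length S ≡ t × EndHomogeneous C S)
end-homogeneous C? zero    L       _           = [] , minimum L , refl , []
end-homogeneous C? (suc t) (x ∷ L) (s≤s bound) with ramsey (C? x) (endBound t) (endBound t) L bound
... | H , H⊆L , colour with diagonal-homogeneous colour
... | |H| , H-homogeneous with end-homogeneous C? t H (≤-reflexive (sym |H|))
... | S , S⊆H , |S| , S-end =
  x ∷ S , refl ∷ ⊆-trans S⊆H H⊆L , cong suc |S| , homogeneous-⊆ S⊆H H-homogeneous ∷ S-end

-- In an end-homogeneous list sorted by an asymmetric order ≺, the elements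
-- ≻ x are exactly those after x, so they form a C x-homogeneous list.
endHomogeneous-at : {C : A → A → A → Set} {_≺_ : A → A → Set} {S : List A} {x : A} →
                    Asymmetric _≺_ → (≺? : Decidable₂ _≺_) →
                    AllPairs _≺_ S → EndHomogeneous C S → x ∈ S →
                    Homogeneous (C x) (filter (≺? x) S)
endHomogeneous-at {C = C} {S = y ∷ S} asym ≺? (y≺ ∷ _) (homogeneous ∷ _) (here refl) =
  subst (Homogeneous (C y)) (sym after-y) homogeneous
  where
  after-y : filter (≺? y) (y ∷ S) ≡ S
  after-y = trans (filter-reject (≺? y) (λ y≺y → asym y≺y y≺y)) (filter-all (≺? y) y≺)
endHomogeneous-at {C = C} {x = x} asym ≺? (y≺ ∷ S≺) (_ ∷ S-end) (there x∈S) =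
  subst (Homogeneous (C x)) (sym (filter-reject (≺? x) (asym (All.lookup y≺ x∈S))))
        (endHomogeneous-at asym ≺? S≺ S-end x∈S)

drop-length-++ : (xs ys : List A) → drop (length xs) (xs ++ ys) ≡ ys
drop-length-++ []       ys = refl
drop-length-++ (x ∷ xs) ys = drop-length-++ xs ys

take-length-++ : (xs ys : List A) → take (length xs) (xs ++ ys) ≡ xs
take-length-++ []       ys = refl
take-length-++ (x ∷ xs) ys = cong (x ∷_) (take-length-++ xs ys)

filter-≈cyc : (P? : Decidable P) {L M : List ℤ} → L ≈cyc M → filter P? L ≈cyc filter P? M
filter-≈cyc P? {L} (k , refl) = length front , (begin
  filter P? (drop k L ++ take k L) ≡⟨ filter-++ P? (drop k L) (take k L) ⟩
  back ++ front                    ≡⟨ rotate-split ⟨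
  rotate (front ++ back)           ≡⟨ cong rotate filtered-L ⟨
  rotate (filter P? L)             ∎)
  where
  open ≡-Reasoning
  front = filter P? (take k L)
  back  = filter P? (drop k L)
  rotate : List ℤ → List ℤ
  rotate xs = drop (length front) xs ++ take (length front) xs
  rotate-split : rotate (front ++ back) ≡ back ++ front
  rotate-split = cong₂ _++_ (drop-length-++ front back) (take-length-++ front back)
  filtered-L : filter P? L ≡ front ++ back
  filtered-L = trans (cong (filter P?) (sym (take++drop≡id k L)))
                     (filter-++ P? (take k L) (drop k L))

filter-reverse : {P : A → Set} (P? : Decidable P) (xs : List A) →
                 filter P? (reverse xs) ≡ reverse (filter P? xs)
filter-reverse P? []       = refl
filter-reverse P? (x ∷ xs) = begin
  filter P? (reverse (x ∷ xs))
    ≡⟨ cong (filter P?) (unfold-reverse x xs) ⟩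
  filter P? (reverse xs ++ [ x ])
    ≡⟨ filter-++ P? (reverse xs) [ x ] ⟩
  filter P? (reverse xs) ++ filter P? [ x ]
    ≡⟨ cong₂ _++_ (filter-reverse P? xs) (sym singleton) ⟩
  reverse (filter P? xs) ++ reverse (filter P? [ x ])
    ≡⟨ reverse-++ (filter P? [ x ]) (filter P? xs) ⟨
  reverse (filter P? [ x ] ++ filter P? xs)
    ≡⟨ cong reverse (filter-++ P? [ x ] xs) ⟨
  reverse (filter P? (x ∷ xs))
    ∎
  where
  open ≡-Reasoning
  singleton : reverse (filter P? [ x ]) ≡ filter P? [ x ]
  singleton with P? x
  ... | yes _ = refl
  ... | no _  = refl

increasing⇒unique : AllPairs _<_ xs → Unique xs
increasing⇒unique = AllPairs.map (λ a<b a≡b → <-irrefl a≡b a<b)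

rearrangement-unique : {G : List ℤ} → AllPairs _<_ G → (P? : Decidable P) →
                       ρ ↭ filter P? G → Unique ρ
rearrangement-unique G< P? ρ↭ =
  Permutation.Unique-resp-↭ (setoid ℤ) (↭⇒↭ₛ (↭-sym ρ↭)) (Unique.filter⁺ P? (increasing⇒unique G<))

module _ {G S : List ℤ} (G< : AllPairs _<_ G) (S⊆G : S ⊆ G) where

  restrict-filter : {P : ℤ → Set} (P? : Decidable P) → filter (_∈? S) (filter P? G) ≡ filter P? S
  restrict-filter P? = sorted-unique <-asym (AllPairs.filter⁺ (_∈? S) (AllPairs.filter⁺ P? G<))
                                            (AllPairs.filter⁺ P? (AllPairs-⊆ S⊆G G<)) to from
    where
    to : ∀ {a} → a ∈ filter (_∈? S) (filter P? G) → a ∈ filter P? S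
    to a∈ with ∈-filter⁻ (_∈? S) {xs = filter P? G} a∈
    ... | a∈PG , a∈S = ∈-filter⁺ P? a∈S (proj₂ (∈-filter⁻ P? {xs = G} a∈PG))
    from : ∀ {a} → a ∈ filter P? S → a ∈ filter (_∈? S) (filter P? G)
    from a∈ with ∈-filter⁻ P? {xs = S} a∈
    ... | a∈S , Pa = ∈-filter⁺ (_∈? S) (∈-filter⁺ P? (lookup S⊆G a∈S) Pa) a∈S

  restrict-↭ : {P : ℤ → Set} {ρ : List ℤ} (P? : Decidable P) →
               ρ ↭ filter P? G → filter (_∈? S) ρ ↭ filter P? S
  restrict-↭ {ρ = ρ} P? ρ↭ = subst (filter (_∈? S) ρ ↭_) (restrict-filter P?) (filter-↭ (_∈? S) ρ↭)

  restrict-separatedAs : ∀ {rot x σ τ} → SeparatedAs G rot x σ τ →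
    SeparatedAs S (induced S rot) x (filter (_∈? S) σ) (filter (_∈? S) τ)
  restrict-separatedAs {x = x} {σ} {τ} (cyclic , σ↭ , τ↭) =
    subst (_ ≈cyc_) (filter-++ (_∈? S) σ τ) (filter-≈cyc (_∈? S) cyclic) ,
    restrict-↭ (_<? x) σ↭ , restrict-↭ (x <?_) τ↭

  forwardMonotoneAt : ∀ {rot x σ τ} → SeparatedAs G rot x σ τ →
    Homogeneous (Precedes τ) (above x S) → ForwardMonotoneAt S (induced S rot) x
  forwardMonotoneAt {rot} {x} {τ = τ} separation@(_ , _ , τ↭) homogeneous =
    _ , _ , restricted ,
    homogeneous-restriction (rearrangement-unique G< (x <?_) τ↭) (filter-⊆ (_∈? S) τ)
                            (proj₂ (proj₂ restricted)) homogeneous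
    where
    restricted = restrict-separatedAs {rot = rot} separation

  backwardMonotoneAt : ∀ {rot x σ τ} → SeparatedAs G rot x σ τ →
    Homogeneous (Precedes σ) (reverse (below x S)) → BackwardMonotoneAt S (induced S rot) x
  backwardMonotoneAt {rot} {x} {σ} separation@(_ , σ↭ , _) homogeneous =
    _ , _ , restricted ,
    unmirror (homogeneous-restriction (rearrangement-unique G< (_<? x) σ↭) (filter-⊆ (_∈? S) σ)
                                      (↭-trans σ↭S (↭-sym (↭-reverse (below x S)))) homogeneous)
    where
    restricted = restrict-separatedAs {rot = rot} separation
    σ↭S = proj₁ (proj₂ restricted)
    unmirror : ∀ {F U : List ℤ} → F ≡ reverse U ⊎ F ≡ reverse (reverse U) → F ≡ U ⊎ F ≡ reverse U
    unmirror (inj₁ F≡U′) = inj₂ F≡U′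
    unmirror (inj₂ F≡U″) = inj₁ (trans F≡U″ (reverse-involutive _))

forwardMonotone : ∀ {S rot} → (∀ {x} → x ∈ S → ForwardMonotoneAt S rot x) → ForwardMonotone S rot
forwardMonotone monotoneAt =
  (λ _ x∈S → let (σ , τ , separation , _) = monotoneAt x∈S in σ , τ , separation) , λ _ → monotoneAt

backwardMonotone : ∀ {S rot} → (∀ {x} → x ∈ S → BackwardMonotoneAt S rot x) → BackwardMonotone S rot
backwardMonotone monotoneAt =
  (λ _ x∈S → let (σ , τ , separation , _) = monotoneAt x∈S in σ , τ , separation) , λ _ → monotoneAt

module _ {G : List ℤ} {rot : ℤ → List ℤ} (G< : AllPairs _<_ G) (separated : Separated G rot) where

  σ τ : ℤ → List ℤ
  σ x with x ∈? G
  ... | yes x∈G = proj₁ (separated x x∈G)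
  ... | no _    = []
  τ x with x ∈? G
  ... | yes x∈G = proj₁ (proj₂ (separated x x∈G))
  ... | no _    = []

  separation : ∀ {x} → x ∈ G → SeparatedAs G rot x (σ x) (τ x)
  separation {x} x∈G with x ∈? G
  ... | yes x∈G′ = proj₂ (proj₂ (separated x x∈G′))
  ... | no x∉G   = ⊥-elim (x∉G x∈G)

  forward-subsystem : ∀ t → endBound t ≤ length G →
    ∃[ S ] (S ⊆ G × length S ≡ t × ForwardMonotone S (induced S rot))
  forward-subsystem t big with end-homogeneous (λ x a b → a ∷ b ∷ [] ⊆? τ x) t G big
  ... | S , S⊆G , |S| , S-end = S , S⊆G , |S| , forwardMonotone monotoneAt
    where
    monotoneAt : ∀ {x} → x ∈ S → ForwardMonotoneAt S (induced S rot) x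
    monotoneAt x∈S = forwardMonotoneAt G< S⊆G {rot = rot} (separation (lookup S⊆G x∈S))
                       (endHomogeneous-at <-asym _<?_ (AllPairs-⊆ S⊆G G<) S-end x∈S)

  backward-subsystem : ∀ t → endBound t ≤ length G →
    ∃[ S ] (S ⊆ G × length S ≡ t × BackwardMonotone S (induced S rot))
  backward-subsystem t big
    with end-homogeneous (λ x a b → a ∷ b ∷ [] ⊆? σ x) t (reverse G)
                         (subst (endBound t ≤_) (sym (length-reverse G)) big)
  ... | S , S⊆Gʳ , |S| , S-end =
    reverse S , S⊆G , trans (length-reverse S) |S| , backwardMonotone monotoneAt
    where
    S⊆G : reverse S ⊆ G
    S⊆G = subst (reverse S ⊆_) (reverse-involutive G) (Sublist.reverse⁺ S⊆Gʳ)
    S> : AllPairs _>_ S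
    S> = AllPairs-⊆ S⊆Gʳ (reverse-sorted G<)
    below-reversed : ∀ x → below x S ≡ reverse (below x (reverse S))
    below-reversed x = sym (trans (cong reverse (filter-reverse (_<? x) S)) (reverse-involutive _))
    monotoneAt : ∀ {x} → x ∈ reverse S → BackwardMonotoneAt (reverse S) (induced (reverse S) rot) x
    monotoneAt {x} x∈S = backwardMonotoneAt G< S⊆G {rot = rot} (separation (lookup S⊆G x∈S))
      (subst (Homogeneous _) (below-reversed x)
             (endHomogeneous-at <-asym (λ a b → b <? a) S> S-end (Any.reverse⁻ x∈S)))

claim2 : (t : ℕ) → 1 ≤ t → ∃[ n₂ ] ((G : List ℤ) (rot : ℤ → List ℤ) →
           IsRotationSystem G rot → Separated G rot → n₂ ≤ length G →
           (∃[ S ] (S ⊆ G × length S ≡ t × ForwardMonotone S (induced S rot)))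
           × (∃[ S ] (S ⊆ G × length S ≡ t × BackwardMonotone S (induced S rot))))
claim2 t _ = endBound t , λ G rot (increasing , _) separated big →
  let G< = Linked⇒AllPairs <-trans increasing
  in forward-subsystem G< separated t big , backward-subsystem G< separated t big
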